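{- Let $s\ge 2$ and $n_1,\ldots,n_s\ge 1$ be integers, $n=n_1+\cdots+n_s$, and let $K_{n_1,\ldots,n_s}$ be the complete $s$-partite graph with partition sets $X_1,\ldots,X_s$, $|X_i|=n_i$. Let $F$ be a spanning forest of $K_{n_1,\ldots,n_s}$ with components $T_1,\ldots,T_c$, and put $n_{ip}=|X_i\cap V(T_p)|$, $m_p=|V(T_p)|$, $\alpha_p=nm_p-\sum_{i=1}^s n_in_{ip}$. Let $Z(x)$ be the $s\times s$ matrix with $(i,j)$ entry $z_{ij}(x)=\delta_{ij}+\sum_{p=1}^c\frac{n_{jp}(m_p-n_{ip})}{x-\alpha_p}$, let $\mathbf{b}=(n_1,\ldots,n_s)^{\top}$, $\mathbf{e}$ the all-ones vector in $\mathbb{R}^s$, and let $\gamma$ be the constant with $\operatorname{adj}Z(0)=\gamma(n\mathbf{e}-\mathbf{b})\mathbf{b}^{\top}$ (equivalently $\gamma=C_{ij}/(n_i(n-n_j))$ for any $i,j$, where $C_{ij}$ is the $(i,j)$ cofactor of $Z(0)$). Then $$\operatorname{tr}\left(-\operatorname{adj}Z(0)\left.\frac{\mathrm{d}Z(x)}{\mathrm{d}x}\right|_{x=0}\right)=c\gamma.$$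
   Context: $\delta_{ij}$ is the Kronecker delta. $\operatorname{adj}M$ is the adjugate of $M$ (its $(i,j)$ entry is the cofactor of $M$ at position $(j,i)$); the cofactor $C_{ij}$ is $(-1)^{i+j}$ times the determinant of the matrix obtained by deleting row $i$ and column $j$. The derivative of $Z(x)$ is taken entrywise. Such a constant $\gamma$ exists. -}

module Defs where

open import Data.Nat as ℕ using (ℕ; zero; suc)
open import Data.Fin as Fin using (Fin; zero; suc; punchIn; toℕ)
open import Data.Integer as ℤ using (+_)
open import Data.Rational as ℚ using (ℚ; 0ℚ; 1ℚ; _+_; _*_; _-_; -_; 1/_)
open import Data.Rational.Properties using () renaming (_≟_ to _≟ℚ_)
open import Data.Product using (Σ; _×_; _,_; proj₁; proj₂; ∃)
open import Data.Sum using (_⊎_)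
open import Data.Unit using (⊤)
open import Data.List using (List; []; _∷_; _++_; length)
open import Data.List.Membership.Propositional using (_∈_)
open import Data.List.Relation.Unary.Unique.Propositional using (Unique)
open import Relation.Binary.PropositionalEquality using (_≡_; _≢_)
open import Relation.Nullary using (yes; no; ¬_)

∑ℕ : ∀ {k} → (Fin k → ℕ) → ℕ
∑ℕ {zero}  f = 0
∑ℕ {suc k} f = f zero ℕ.+ ∑ℕ (λ i → f (suc i))

∑ : ∀ {k} → (Fin k → ℚ) → ℚ
∑ {zero}  f = 0ℚ
∑ {suc k} f = f zero + ∑ (λ i → f (suc i))

⟦_⟧ : ℕ → ℚ
⟦ k ⟧ = + k ℚ./ 1

-- inverse, with the (never used here) convention 1/0 := 0
inv : ℚ → ℚ
inv q with q ≟ℚ 0ℚ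
... | yes _  = 0ℚ
... | no q≢0 = 1/_ q {{ℚ.≢-nonZero q≢0}}

Matrix : ℕ → Set
Matrix k = Fin k → Fin k → ℚ

sign : ℕ → ℚ
sign zero          = 1ℚ
sign (suc zero)    = - 1ℚ
sign (suc (suc k)) = sign k

minor : ∀ {k} → Fin (suc k) → Fin (suc k) → Matrix (suc k) → Matrix k
minor i j M a b = M (punchIn i a) (punchIn j b)

det : ∀ {k} → Matrix k → ℚ
det {zero}  M = 1ℚ
det {suc k} M = ∑ λ j → sign (toℕ j) * M zero j * det (minor zero j M)

cofactor : ∀ {k} → Matrix k → Fin k → Fin k → ℚ
cofactor {zero}  M () _
cofactor {suc k} M i j = sign (toℕ i ℕ.+ toℕ j) * det (minor i j M)

adj : ∀ {k} → Matrix k → Matrix k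
adj M i j = cofactor M j i

_⊗_ : ∀ {k} → Matrix k → Matrix k → Matrix k
(A ⊗ B) i j = ∑ λ l → A i l * B l j

tr : ∀ {k} → Matrix k → ℚ
tr A = ∑ λ i → A i i

δ : ∀ {k} → Fin k → Fin k → ℚ
δ i j with i Fin.≟ j
... | yes _ = 1ℚ
... | no _  = 0ℚ

-- Complete multipartite graph K_{n_1,...,n_s}: vertices are pairs (i , x)
-- with i : Fin s the part and x : Fin (ns i); two vertices adjacent iff
-- they lie in different parts.

Vertex : (s : ℕ) → (Fin s → ℕ) → Set
Vertex s ns = Σ (Fin s) (λ i → Fin (ns i))

module Graph (s : ℕ) (ns : Fin s → ℕ) where

  V : Set
  V = Vertex s ns

  Edges : Set
  Edges = List (V × V)

  SubgraphOfK : Edges → Set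
  SubgraphOfK F = ∀ {u v} → (u , v) ∈ F → proj₁ u ≢ proj₁ v

  Adj : Edges → V → V → Set
  Adj F u v = ((u , v) ∈ F) ⊎ ((v , u) ∈ F)

  data Reach (F : Edges) : V → V → Set where
    here : ∀ {u} → Reach F u u
    step : ∀ {u w v} → Adj F u w → Reach F w v → Reach F u v

  AdjChain : Edges → List V → Set
  AdjChain F []           = ⊤
  AdjChain F (x ∷ [])     = ⊤
  AdjChain F (x ∷ y ∷ zs) = Adj F x y × AdjChain F (y ∷ zs)

  IsCycle : Edges → List V → Set
  IsCycle F []       = Data.Empty.⊥
    where import Data.Empty
  IsCycle F (v ∷ ws) =
    (3 ℕ.≤ suc (length ws)) × Unique (v ∷ ws) × AdjChain F (v ∷ ws ++ v ∷ [])

  IsForest : Edges → Set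
  IsForest F = ∀ cyc → ¬ IsCycle F cyc

  IsComponentLabelling : Edges → (c : ℕ) → (V → Fin c) → Set
  IsComponentLabelling F c comp =
    (∀ u v → (comp u ≡ comp v → Reach F u v) × (Reach F u v → comp u ≡ comp v))
    × (∀ p → ∃ λ v → comp v ≡ p)

  nip : ∀ {c} → (V → Fin c) → Fin s → Fin c → ℕ
  nip comp i p = ∑ℕ λ (x : Fin (ns i)) → indicator (comp (i , x) Fin.≟ p)
    where
    indicator : ∀ {A : Set} → Relation.Nullary.Dec A → ℕ
    indicator (yes _) = 1
    indicator (no _)  = 0

  mp : ∀ {c} → (V → Fin c) → Fin c → ℕ
  mp comp p = ∑ℕ λ i → nip comp i p

  ntot : ℕ
  ntot = ∑ℕ ns

  α : ∀ {c} → (V → Fin c) → Fin c → ℚ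
  α comp p = ⟦ ntot ⟧ * ⟦ mp comp p ⟧ - ∑ (λ i → ⟦ ns i ⟧ * ⟦ nip comp i p ⟧)

  coef : ∀ {c} → (V → Fin c) → Fin s → Fin s → Fin c → ℚ
  coef comp i j p = ⟦ nip comp j p ⟧ * (⟦ mp comp p ⟧ - ⟦ nip comp i p ⟧)

  Z0 : ∀ {c} → (V → Fin c) → Matrix s
  Z0 comp i j = δ i j + ∑ λ p → coef comp i j p * inv (0ℚ - α comp p)

  -- Z'(0): d/dx [coef/(x - α_p)] = - coef/(x - α_p)^2, evaluated at x = 0
  dZ0 : ∀ {c} → (V → Fin c) → Matrix s
  dZ0 comp i j = ∑ λ p →
    - (coef comp i j p * inv ((0ℚ - α comp p) * (0ℚ - α comp p)))

{-# OPTIONS --safe #-}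
-- By hypothesis adj Z(0) is the rank-one matrix γ (n e − b) bᵀ, and
-- Z'(0) = − Σ_p α_p⁻² y_p x_pᵀ with (y_p)_i = m_p − n_ip and (x_p)_j = n_jp.
-- So the trace splits over the components as
-- γ Σ_p α_p⁻² (Σ_i (n − n_i) n_ip) (Σ_l n_l (m_p − n_lp)), and both sums equal α_p.
-- As s ≥ 2 and all n_i ≥ 1, every n − n_i is positive, and every component meets
-- some part; hence α_p > 0 and each component contributes exactly γ.
module Submission where

open import Defs
open import Algebra.Bundles using (CommutativeRing)
import Algebra.Properties.CommutativeMonoid.Sum as CommutativeMonoidSum
import Algebra.Properties.Semiring.Sum as SemiringSum
open import Data.Nat as ℕ using (ℕ; zero; suc; _≤_; z≤n; s≤s)
import Data.Nat.Properties as ℕ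
open import Data.Nat.Coprimality using (1-coprimeTo) renaming (sym to coprime-sym)
open import Data.Fin as Fin using (Fin; zero; suc)
import Data.Integer as ℤ
import Data.Integer.Properties as ℤ
open import Data.Rational as ℚ using (ℚ; mkℚ; 0ℚ; 1ℚ; _+_; _*_; -_; _-_)
import Data.Rational.Properties as ℚ
open import Data.Rational.Solver using (module +-*-Solver)
open import Data.Product using (_,_; ∃)
open import Data.Vec.Functional using (removeAt)
open import Function using (_∘_; _∋_; flip)
open import Relation.Binary.PropositionalEquality
open import Relation.Nullary using (yes; no; contradiction)

open +-*-Solver using (solve; con; _:+_; _:*_; _:-_; :-_; _:=_)

module Σℕ = CommutativeMonoidSum ℕ.+-0-commutativeMonoid
module Σℚ = SemiringSum (CommutativeRing.semiring ℚ.+-*-commutativeRing)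

∑ℕ≡sum : ∀ {k} (f : Fin k → ℕ) → ∑ℕ f ≡ Σℕ.sum f
∑ℕ≡sum {zero}  f = refl
∑ℕ≡sum {suc k} f = cong (f zero ℕ.+_) (∑ℕ≡sum (f ∘ suc))

∑ℕ-remove : ∀ {k} (f : Fin (suc k) → ℕ) i → ∑ℕ f ≡ f i ℕ.+ ∑ℕ (removeAt f i)
∑ℕ-remove f i = begin
  ∑ℕ f                                 ≡⟨ ∑ℕ≡sum f ⟩
  Σℕ.sum f                             ≡⟨ Σℕ.sum-remove {i = i} f ⟩
  f i ℕ.+ Σℕ.sum (removeAt f i)        ≡⟨ cong (f i ℕ.+_) (∑ℕ≡sum (removeAt f i)) ⟨
  f i ℕ.+ ∑ℕ (removeAt f i)            ∎
  where open ≡-Reasoning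

term≤∑ℕ : ∀ {k} (f : Fin k → ℕ) i → f i ≤ ∑ℕ f
term≤∑ℕ {suc k} f i = subst (f i ≤_) (sym (∑ℕ-remove f i)) (ℕ.m≤m+n (f i) _)

∑≡sum : ∀ {k} (f : Fin k → ℚ) → ∑ f ≡ Σℚ.sum f
∑≡sum {zero}  f = refl
∑≡sum {suc k} f = cong (f zero +_) (∑≡sum (f ∘ suc))

∑-cong : ∀ {k} {f g : Fin k → ℚ} → (∀ i → f i ≡ g i) → ∑ f ≡ ∑ g
∑-cong {f = f} {g} f≗g = trans (∑≡sum f) (trans (Σℚ.sum-cong-≗ f≗g) (sym (∑≡sum g)))

∑-comm : ∀ {m n} (f : Fin m → Fin n → ℚ) →
         ∑ (λ i → ∑ (f i)) ≡ ∑ (λ j → ∑ (λ i → f i j))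
∑-comm f = begin
  ∑ (λ i → ∑ (f i))                  ≡⟨ ∑∑≡sumsum f ⟩
  Σℚ.sum (λ i → Σℚ.sum (f i))        ≡⟨ Σℚ.∑-comm f ⟩
  Σℚ.sum (λ j → Σℚ.sum (flip f j))   ≡⟨ ∑∑≡sumsum (flip f) ⟨
  ∑ (λ j → ∑ (flip f j))             ∎
  where
  open ≡-Reasoning
  ∑∑≡sumsum : ∀ {m n} (g : Fin m → Fin n → ℚ) → ∑ (λ i → ∑ (g i)) ≡ Σℚ.sum (λ i → Σℚ.sum (g i))
  ∑∑≡sumsum g = trans (∑≡sum (λ i → ∑ (g i))) (Σℚ.sum-cong-≗ (∑≡sum ∘ g))

*-distribˡ-∑ : ∀ {k} a (f : Fin k → ℚ) → a * ∑ f ≡ ∑ (λ i → a * f i)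
*-distribˡ-∑ a f = begin
  a * ∑ f                   ≡⟨ cong (a *_) (∑≡sum f) ⟩
  a * Σℚ.sum f              ≡⟨ Σℚ.*-distribˡ-sum a f ⟩
  Σℚ.sum (λ i → a * f i)    ≡⟨ ∑≡sum (λ i → a * f i) ⟨
  ∑ (λ i → a * f i)         ∎
  where open ≡-Reasoning

*-distribʳ-∑ : ∀ {k} a (f : Fin k → ℚ) → ∑ f * a ≡ ∑ (λ i → f i * a)
*-distribʳ-∑ a f = begin
  ∑ f * a                   ≡⟨ cong (_* a) (∑≡sum f) ⟩
  Σℚ.sum f * a              ≡⟨ Σℚ.*-distribʳ-sum a f ⟩
  Σℚ.sum (λ i → f i * a)    ≡⟨ ∑≡sum (λ i → f i * a) ⟨
  ∑ (λ i → f i * a)         ∎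
  where open ≡-Reasoning

∑-distrib-- : ∀ {k} (f g : Fin k → ℚ) → ∑ (λ i → f i - g i) ≡ ∑ f - ∑ g
∑-distrib-- {zero}  f g = refl
∑-distrib-- {suc k} f g =
  trans (cong (f zero - g zero +_) (∑-distrib-- (f ∘ suc) (g ∘ suc)))
        (solve 4 (λ a b c d → (a :- b) :+ (c :- d) := (a :+ c) :- (b :+ d)) refl
               (f zero) (g zero) (∑ (f ∘ suc)) (∑ (g ∘ suc)))

∑-*-∑ : ∀ {m n} (f : Fin m → ℚ) (g : Fin n → ℚ) → ∑ f * ∑ g ≡ ∑ (λ i → ∑ (λ j → f i * g j))
∑-*-∑ f g = trans (*-distribʳ-∑ (∑ g) f) (∑-cong (λ i → *-distribˡ-∑ (f i) g))

∑[c-f]g≡c∑g-∑fg : ∀ {k} c (f g : Fin k → ℚ) →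
                  ∑ (λ i → (c - f i) * g i) ≡ c * ∑ g - ∑ (λ i → f i * g i)
∑[c-f]g≡c∑g-∑fg c f g = begin
  ∑ (λ i → (c - f i) * g i)              ≡⟨ ∑-cong (λ i → ℚ.*-distribʳ-+ (g i) c (- f i)) ⟩
  ∑ (λ i → c * g i + - f i * g i)        ≡⟨ ∑-cong (λ i → cong (c * g i +_) (ℚ.neg-distribˡ-* (f i) (g i))) ⟨
  ∑ (λ i → c * g i - f i * g i)          ≡⟨ ∑-distrib-- (λ i → c * g i) (λ i → f i * g i) ⟩
  ∑ (λ i → c * g i) - ∑ (λ i → f i * g i) ≡⟨ cong (_- ∑ (λ i → f i * g i)) (*-distribˡ-∑ c g) ⟨
  c * ∑ g - ∑ (λ i → f i * g i)          ∎
  where open ≡-Reasoning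

∑f[c-g]≡∑f*c-∑fg : ∀ {k} c (f g : Fin k → ℚ) →
                   ∑ (λ i → f i * (c - g i)) ≡ ∑ f * c - ∑ (λ i → f i * g i)
∑f[c-g]≡∑f*c-∑fg c f g = begin
  ∑ (λ i → f i * (c - g i))              ≡⟨ ∑-cong (λ i → ℚ.*-distribˡ-+ (f i) c (- g i)) ⟩
  ∑ (λ i → f i * c + f i * - g i)        ≡⟨ ∑-cong (λ i → cong (f i * c +_) (ℚ.neg-distribʳ-* (f i) (g i))) ⟨
  ∑ (λ i → f i * c - f i * g i)          ≡⟨ ∑-distrib-- (λ i → f i * c) (λ i → f i * g i) ⟩
  ∑ (λ i → f i * c) - ∑ (λ i → f i * g i) ≡⟨ cong (_- ∑ (λ i → f i * g i)) (*-distribʳ-∑ c f) ⟨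
  ∑ f * c - ∑ (λ i → f i * g i)          ∎
  where open ≡-Reasoning

-- ⟦ k ⟧ is a fraction with denominator 1, so the homomorphism laws below reduce to ℤ.
⟦⟧≡mkℚ : ∀ k → ⟦ k ⟧ ≡ mkℚ (ℤ.+ k) 0 (coprime-sym (1-coprimeTo k))
⟦⟧≡mkℚ k = ℚ.normalize-coprime (coprime-sym (1-coprimeTo k))

⟦⟧-homo-+ : ∀ a b → ⟦ a ℕ.+ b ⟧ ≡ ⟦ a ⟧ + ⟦ b ⟧
⟦⟧-homo-+ a b = sym (trans (cong₂ _+_ (⟦⟧≡mkℚ a) (⟦⟧≡mkℚ b))
  (ℚ./-cong {p₂ = ℤ.+ (a ℕ.+ b)} {q₂ = 1} (cong₂ ℤ._+_ (ℤ.*-identityʳ (ℤ.+ a)) (ℤ.*-identityʳ (ℤ.+ b))) refl))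

⟦⟧-homo-* : ∀ a b → ⟦ a ℕ.* b ⟧ ≡ ⟦ a ⟧ * ⟦ b ⟧
⟦⟧-homo-* a b = sym (trans (cong₂ _*_ (⟦⟧≡mkℚ a) (⟦⟧≡mkℚ b))
  (ℚ./-cong {p₂ = ℤ.+ (a ℕ.* b)} {q₂ = 1} (sym (ℤ.pos-* a b)) refl))

⟦⟧-homo-∑ : ∀ {k} (f : Fin k → ℕ) → ⟦ ∑ℕ f ⟧ ≡ ∑ (λ i → ⟦ f i ⟧)
⟦⟧-homo-∑ {zero}  f = refl
⟦⟧-homo-∑ {suc k} f = trans (⟦⟧-homo-+ (f zero) _) (cong (⟦ f zero ⟧ +_) (⟦⟧-homo-∑ (f ∘ suc)))

∑-1ℚ : ∀ k → ∑ {k} (λ _ → 1ℚ) ≡ ⟦ k ⟧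
∑-1ℚ zero    = refl
∑-1ℚ (suc k) = trans (cong (1ℚ +_) (∑-1ℚ k)) (sym (⟦⟧-homo-+ 1 k))

⟦⟧≢0 : ∀ {k} → 1 ≤ k → ⟦ k ⟧ ≢ 0ℚ
⟦⟧≢0 {suc k} _ eq with trans (sym (cong ℚ.↥_ (⟦⟧≡mkℚ (suc k)))) (cong ℚ.↥_ eq)
... | ()

inv-inverseˡ : ∀ {q} → q ≢ 0ℚ → inv q * q ≡ 1ℚ
inv-inverseˡ {q} q≢0 with q ℚ.≟ 0ℚ
... | yes q≡0 = contradiction q≡0 q≢0
... | no q≢0′ = ℚ.*-inverseˡ q {{ℚ.≢-nonZero q≢0′}}

tr-outer-⊗-∑ : ∀ {s c} (γ : ℚ) (u v : Fin s → ℚ) (w : Fin c → ℚ) (x y : Fin s → Fin c → ℚ) →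
  tr ((λ i l → - (γ * (u i * v l))) ⊗ (λ l i → ∑ λ p → - (x i p * y l p * w p)))
    ≡ γ * ∑ (λ p → w p * (∑ (λ i → u i * x i p) * ∑ (λ l → v l * y l p)))
tr-outer-⊗-∑ γ u v w x y = begin
  ∑ (λ i → ∑ (λ l → - (γ * (u i * v l)) * ∑ (λ p → - (x i p * y l p * w p))))
    ≡⟨ ∑-cong (λ i → ∑-cong (λ l → *-distribˡ-∑ (- (γ * (u i * v l))) (λ p → - (x i p * y l p * w p)))) ⟩
  ∑ (λ i → ∑ (λ l → ∑ (λ p → - (γ * (u i * v l)) * - (x i p * y l p * w p))))
    ≡⟨ ∑-cong (λ i → ∑-cong (λ l → ∑-cong (λ p → regroup (u i) (v l) (x i p) (y l p) (w p)))) ⟩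
  ∑ (λ i → ∑ (λ l → ∑ (λ p → t p i l)))
    ≡⟨ ∑-cong (λ i → ∑-comm (λ l p → t p i l)) ⟩
  ∑ (λ i → ∑ (λ p → ∑ (λ l → t p i l)))
    ≡⟨ ∑-comm (λ i p → ∑ (λ l → t p i l)) ⟩
  ∑ (λ p → ∑ (λ i → ∑ (λ l → t p i l)))
    ≡⟨ ∑-cong (λ p → ∑-*-∑ (λ i → γ * w p * (u i * x i p)) (λ l → v l * y l p)) ⟨
  ∑ (λ p → ∑ (λ i → γ * w p * (u i * x i p)) * Y p)
    ≡⟨ ∑-cong (λ p → cong (_* Y p) (*-distribˡ-∑ (γ * w p) (λ i → u i * x i p))) ⟨
  ∑ (λ p → γ * w p * X p * Y p)
    ≡⟨ ∑-cong (λ p → solve 4 (λ g W a b → g :* W :* a :* b := g :* (W :* (a :* b))) refl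
                               γ (w p) (X p) (Y p)) ⟩
  ∑ (λ p → γ * (w p * (X p * Y p)))
    ≡⟨ *-distribˡ-∑ γ (λ p → w p * (X p * Y p)) ⟨
  γ * ∑ (λ p → w p * (X p * Y p)) ∎
  where
  open ≡-Reasoning
  X Y : Fin _ → ℚ
  X p = ∑ (λ i → u i * x i p)
  Y p = ∑ (λ l → v l * y l p)
  t : Fin _ → Fin _ → Fin _ → ℚ
  t p i l = γ * w p * (u i * x i p) * (v l * y l p)
  regroup : ∀ a b c d e → - (γ * (a * b)) * - (c * d * e) ≡ γ * e * (a * c) * (b * d)
  regroup = solve 6 (λ g a b c d e → (:- (g :* (a :* b))) :* (:- (c :* d :* e))
                                    := g :* e :* (a :* c) :* (b :* d)) refl γ

⟦∑ℕ-removeAt⟧ : ∀ {k} (f : Fin (suc k) → ℕ) i → ⟦ ∑ℕ (removeAt f i) ⟧ ≡ ⟦ ∑ℕ f ⟧ - ⟦ f i ⟧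
⟦∑ℕ-removeAt⟧ f i = begin
  ⟦ ∑ℕ (removeAt f i) ⟧                            ≡⟨ solve 2 (λ a b → b := (a :+ b) :- a) refl ⟦ f i ⟧ _ ⟩
  ⟦ f i ⟧ + ⟦ ∑ℕ (removeAt f i) ⟧ - ⟦ f i ⟧         ≡⟨ cong (_- ⟦ f i ⟧) (⟦⟧-homo-+ (f i) _) ⟨
  ⟦ f i ℕ.+ ∑ℕ (removeAt f i) ⟧ - ⟦ f i ⟧          ≡⟨ cong (λ n → ⟦ n ⟧ - ⟦ f i ⟧) (∑ℕ-remove f i) ⟨
  ⟦ ∑ℕ f ⟧ - ⟦ f i ⟧                               ∎
  where open ≡-Reasoning

module Components {s} (ns : Fin s → ℕ) {c} (comp : Vertex s ns → Fin c) where
  open Graph s ns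

  α≡∑[n-nᵢ]nᵢₚ : ∀ p → α comp p ≡ ∑ (λ i → (⟦ ntot ⟧ - ⟦ ns i ⟧) * ⟦ nip comp i p ⟧)
  α≡∑[n-nᵢ]nᵢₚ p = begin
    ⟦ ntot ⟧ * ⟦ mp comp p ⟧ - ∑ (λ i → ⟦ ns i ⟧ * ⟦ nip comp i p ⟧)
      ≡⟨ cong (λ m → ⟦ ntot ⟧ * m - ∑ (λ i → ⟦ ns i ⟧ * ⟦ nip comp i p ⟧)) (⟦⟧-homo-∑ (λ i → nip comp i p)) ⟩
    ⟦ ntot ⟧ * ∑ (λ i → ⟦ nip comp i p ⟧) - ∑ (λ i → ⟦ ns i ⟧ * ⟦ nip comp i p ⟧)
      ≡⟨ ∑[c-f]g≡c∑g-∑fg ⟦ ntot ⟧ (λ i → ⟦ ns i ⟧) (λ i → ⟦ nip comp i p ⟧) ⟨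
    ∑ (λ i → (⟦ ntot ⟧ - ⟦ ns i ⟧) * ⟦ nip comp i p ⟧) ∎
    where open ≡-Reasoning

  α≡∑nᵢ[mₚ-nᵢₚ] : ∀ p → α comp p ≡ ∑ (λ i → ⟦ ns i ⟧ * (⟦ mp comp p ⟧ - ⟦ nip comp i p ⟧))
  α≡∑nᵢ[mₚ-nᵢₚ] p = begin
    ⟦ ntot ⟧ * ⟦ mp comp p ⟧ - ∑ (λ i → ⟦ ns i ⟧ * ⟦ nip comp i p ⟧)
      ≡⟨ cong (λ n → n * ⟦ mp comp p ⟧ - ∑ (λ i → ⟦ ns i ⟧ * ⟦ nip comp i p ⟧)) (⟦⟧-homo-∑ ns) ⟩
    ∑ (λ i → ⟦ ns i ⟧) * ⟦ mp comp p ⟧ - ∑ (λ i → ⟦ ns i ⟧ * ⟦ nip comp i p ⟧)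
      ≡⟨ ∑f[c-g]≡∑f*c-∑fg ⟦ mp comp p ⟧ (λ i → ⟦ ns i ⟧) (λ i → ⟦ nip comp i p ⟧) ⟨
    ∑ (λ i → ⟦ ns i ⟧ * (⟦ mp comp p ⟧ - ⟦ nip comp i p ⟧)) ∎
    where open ≡-Reasoning

  -- The x-th summand of nip comp i p is the indicator of comp (i , x) ≡ p.
  1≤nip : ∀ {i p} x → comp (i , x) ≡ p → 1 ≤ nip comp i p
  1≤nip {i} {p} x eq with comp (i , x) Fin.≟ p | (_ ≤ nip comp i p ∋ term≤∑ℕ _ x)
  ... | yes _  | 1≤ = 1≤
  ... | no neq | _  = contradiction eq neq

module Alphaℕ {t} (ns : Fin (suc t) → ℕ) {c} (comp : Vertex (suc t) ns → Fin c) where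
  open Graph (suc t) ns
  open Components ns comp

  -- n − n_i is written as the total size of the other parts, avoiding truncated subtraction.
  αℕ : Fin c → ℕ
  αℕ p = ∑ℕ (λ i → ∑ℕ (removeAt ns i) ℕ.* nip comp i p)

  α≡⟦αℕ⟧ : ∀ p → α comp p ≡ ⟦ αℕ p ⟧
  α≡⟦αℕ⟧ p = begin
    α comp p
      ≡⟨ α≡∑[n-nᵢ]nᵢₚ p ⟩
    ∑ (λ i → (⟦ ntot ⟧ - ⟦ ns i ⟧) * ⟦ nip comp i p ⟧)
      ≡⟨ ∑-cong (λ i → cong (_* ⟦ nip comp i p ⟧) (⟦∑ℕ-removeAt⟧ ns i)) ⟨
    ∑ (λ i → ⟦ ∑ℕ (removeAt ns i) ⟧ * ⟦ nip comp i p ⟧)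
      ≡⟨ ∑-cong (λ i → ⟦⟧-homo-* (∑ℕ (removeAt ns i)) (nip comp i p)) ⟨
    ∑ (λ i → ⟦ ∑ℕ (removeAt ns i) ℕ.* nip comp i p ⟧)
      ≡⟨ ⟦⟧-homo-∑ (λ i → ∑ℕ (removeAt ns i) ℕ.* nip comp i p) ⟨
    ⟦ αℕ p ⟧ ∎
    where open ≡-Reasoning

  trace-summand≡1 : ∀ p → 1 ≤ αℕ p →
    inv ((0ℚ - α comp p) * (0ℚ - α comp p))
      * (∑ (λ i → (⟦ ntot ⟧ - ⟦ ns i ⟧) * ⟦ nip comp i p ⟧)
         * ∑ (λ l → ⟦ ns l ⟧ * (⟦ mp comp p ⟧ - ⟦ nip comp l p ⟧)))
      ≡ 1ℚ
  trace-summand≡1 p 1≤αℕp = begin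
    inv ((0ℚ - a) * (0ℚ - a)) * (∑ (λ i → (⟦ ntot ⟧ - ⟦ ns i ⟧) * ⟦ nip comp i p ⟧)
                                 * ∑ (λ l → ⟦ ns l ⟧ * (⟦ mp comp p ⟧ - ⟦ nip comp l p ⟧)))
      ≡⟨ cong₂ (λ q r → inv q * r) (sym [0-a]²≡a²) (cong₂ _*_ (α≡∑[n-nᵢ]nᵢₚ p) (α≡∑nᵢ[mₚ-nᵢₚ] p)) ⟨
    inv (a * a) * (a * a)
      ≡⟨ inv-inverseˡ a²≢0 ⟩
    1ℚ ∎
    where
    open ≡-Reasoning
    a = α comp p
    [0-a]²≡a² : (0ℚ - a) * (0ℚ - a) ≡ a * a
    [0-a]²≡a² = solve 1 (λ a → (con 0ℚ :- a) :* (con 0ℚ :- a) := a :* a) refl a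
    a²≢0 : a * a ≢ 0ℚ
    a²≢0 a²≡0 = ⟦⟧≢0 (ℕ.*-mono-≤ 1≤αℕp 1≤αℕp) (begin
      ⟦ αℕ p ℕ.* αℕ p ⟧     ≡⟨ ⟦⟧-homo-* (αℕ p) (αℕ p) ⟩
      ⟦ αℕ p ⟧ * ⟦ αℕ p ⟧   ≡⟨ cong₂ _*_ (α≡⟦αℕ⟧ p) (α≡⟦αℕ⟧ p) ⟨
      a * a                 ≡⟨ a²≡0 ⟩
      0ℚ                    ∎)

1≤αℕ : ∀ {t c} (ns : Fin (suc (suc t)) → ℕ) (comp : Vertex (suc (suc t)) ns → Fin c) →
       (∀ i → 1 ≤ ns i) → (∀ p → ∃ λ v → comp v ≡ p) → ∀ p → 1 ≤ Alphaℕ.αℕ ns comp p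
1≤αℕ ns comp ns≥1 surj p with surj p
... | (i , x) , eq = ℕ.≤-trans (ℕ.*-mono-≤ 1≤∑others (Components.1≤nip ns comp x eq))
                                (term≤∑ℕ (λ j → ∑ℕ (removeAt ns j) ℕ.* Graph.nip _ ns comp j p) i)
  where
  1≤∑others : 1 ≤ ∑ℕ (removeAt ns i)
  1≤∑others = ℕ.≤-trans (ns≥1 _) (term≤∑ℕ (removeAt ns i) zero)

proposition4p4 : (s : ℕ) → 2 ≤ s → (ns : Fin s → ℕ) → (∀ i → 1 ≤ ns i) →
    let open Graph s ns in
    (F : Edges) → SubgraphOfK F → IsForest F →
    (c : ℕ) → (comp : V → Fin c) → IsComponentLabelling F c comp →
    (γ : ℚ) →
    (∀ i j → adj (Z0 comp) i j ≡ γ * ((⟦ ntot ⟧ - ⟦ ns i ⟧) * ⟦ ns j ⟧)) →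
    tr ((λ i j → - adj (Z0 comp) i j) ⊗ dZ0 comp) ≡ ⟦ c ⟧ * γ
proposition4p4 (suc (suc t)) (s≤s (s≤s z≤n)) ns ns≥1 _ _ _ c comp (_ , surj) γ adj≡ = begin
  tr ((λ i j → - adj (Z0 comp) i j) ⊗ dZ0 comp)
    ≡⟨ ∑-cong (λ i → ∑-cong (λ l → cong (λ a → - a * dZ0 comp l i) (adj≡ i l))) ⟩
  tr ((λ i l → - (γ * ((⟦ ntot ⟧ - ⟦ ns i ⟧) * ⟦ ns l ⟧))) ⊗ dZ0 comp)
    ≡⟨ tr-outer-⊗-∑ γ (λ i → ⟦ ntot ⟧ - ⟦ ns i ⟧) (λ l → ⟦ ns l ⟧)
                      (λ p → inv ((0ℚ - α comp p) * (0ℚ - α comp p)))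
                      (λ i p → ⟦ nip comp i p ⟧) (λ l p → ⟦ mp comp p ⟧ - ⟦ nip comp l p ⟧) ⟩
  γ * ∑ (λ p → inv ((0ℚ - α comp p) * (0ℚ - α comp p))
               * (∑ (λ i → (⟦ ntot ⟧ - ⟦ ns i ⟧) * ⟦ nip comp i p ⟧)
                  * ∑ (λ l → ⟦ ns l ⟧ * (⟦ mp comp p ⟧ - ⟦ nip comp l p ⟧))))
    ≡⟨ cong (γ *_) (∑-cong (λ p → trace-summand≡1 p (1≤αℕ ns comp ns≥1 surj p))) ⟩
  γ * ∑ {c} (λ _ → 1ℚ)
    ≡⟨ cong (γ *_) (∑-1ℚ c) ⟩
  γ * ⟦ c ⟧
    ≡⟨ ℚ.*-comm γ ⟦ c ⟧ ⟩
  ⟦ c ⟧ * γ ∎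
  where
  open Graph (suc (suc t)) ns
  open Alphaℕ ns comp
  open ≡-Reasoning
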